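{- Every quasiregular coherent configuration with at most three homogeneous components is schurian and separable.
   Context: A coherent configuration is a pair $\mathcal X=(\Omega,S)$ where $\Omega$ is a finite set and $S$ is a partition of $\Omega\times\Omega$ (basis relations) such that the diagonal $1_\Omega$ is a union of basis relations, $s^*=\{(\beta,\alpha):(\alpha,\beta)\in s\}\in S$ for all $s\in S$, and for all $r,s,t\in S$ the number $c^t_{rs}=|\alpha r\cap \beta s^*|$ does not depend on the choice of $(\alpha,\beta)\in t$, where $\alpha r=\{\beta:(\alpha,\beta)\in r\}$. A fiber is a set $\Delta$ with $1_\Delta\in S$; homogeneous components are $(\Delta,\{s\in S:s\subseteq\Delta\times\Delta\})$ for fibers $\Delta$. A relation $s$ is thin if $|\alpha s|\le1$ and $|\alpha s^*|\le 1$ for all $\alpha$. A regular scheme is a coherent configuration with one fiber all of whose basis relations are thin. A coherent configuration is quasiregular if all its homogeneous components are regular schemes. It is schurian if $S$ is the set of orbits on $\Omega\times\Omega$ of some permutation group on $\Omega$. An algebraic isomorphism from $(\Omega,S)$ to a coherent configuration $(\Omega',S')$ is a bijection $\varphi:S\to S'$ with $c^t_{rs}=c^{\varphi(t)}_{\varphi(r)\varphi(s)}$ for all $r,s,t$; the configuration is separable if for every such $\varphi$ there is a bijection $f:\Omega\to\Omega'$ with $\{(\alpha^f,\beta^f):(\alpha,\beta)\in s\}=\varphi(s)$ for all $s\in S$. -}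

module Defs where

open import Data.Nat using (ℕ; _≤_)
open import Data.Fin using (Fin)
open import Data.Fin.Properties using (_≟_; any?)
open import Data.Fin.Permutation using (Permutation; Permutation′; _⟨$⟩ʳ_; id; flip; _∘ₚ_)
open import Data.Product using (Σ; ∃; _×_; _,_)
open import Relation.Nullary using (Dec; yes; no; ¬_)
open import Relation.Nullary.Decidable using (_×-dec_)
open import Relation.Unary using (Decidable)
open import Relation.Binary.PropositionalEquality using (_≡_)
open import Function.Bundles using (_⇔_)

count : ∀ {k} {P : Fin k → Set} → Decidable P → ℕ
count {ℕ.zero} d = 0
count {ℕ.suc k} d with d Fin.zero
... | yes _ = ℕ.suc (count {k} (λ i → d (Fin.suc i)))
... | no _ = count {k} (λ i → d (Fin.suc i))

-- A coherent configuration on Ω = Fin n with m basis relations.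
-- The partition S of Ω × Ω is encoded by a colouring  col : Ω → Ω → Fin m;
-- the basis relation with index r is { (α , β) | col α β ≡ r }.
record CC : Set where
  field
    n : ℕ
    m : ℕ
    col : Fin n → Fin n → Fin m
    nonempty : ∀ r → ∃ λ α → ∃ λ β → col α β ≡ r
    -- the diagonal 1_Ω is a union of basis relations
    diag : ∀ α γ δ → col α α ≡ col γ δ → γ ≡ δ
    -- s* is a basis relation for every s: tr s is the index of s*
    tr : Fin m → Fin m
    tr-spec : ∀ r γ δ → (col γ δ ≡ tr r ⇔ col δ γ ≡ r)

  inter : Fin n → Fin n → Fin m → Fin m → ℕ
  inter α β r s = count (λ γ → (col α γ ≟ r) ×-dec (col γ β ≟ s))

  field
    coherent : ∀ r s α β α' β' → col α β ≡ col α' β' → inter α β r s ≡ inter α' β' r s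

open CC public

module _ (X : CC) where
  Thin : Fin (m X) → Set
  Thin s = (∀ α β γ → col X α β ≡ s → col X α γ ≡ s → β ≡ γ)
         × (∀ α β γ → col X β α ≡ s → col X γ α ≡ s → β ≡ γ)

  -- r is the index of 1_Δ for a fiber Δ (a basis relation contained in the diagonal)
  FiberRel : Fin (m X) → Set
  FiberRel r = ∀ α β → col X α β ≡ r → α ≡ β

  -- s is a basis relation of the homogeneous component on the fiber Δ = { α | col α α ≡ r }
  InComponent : Fin (m X) → Fin (m X) → Set
  InComponent r s = ∀ α β → col X α β ≡ s → col X α α ≡ r × col X β β ≡ r

  -- quasiregular: every homogeneous component is a regular scheme,
  -- i.e. all basis relations of every homogeneous component are thin
  Quasiregular : Set
  Quasiregular = ∀ r s → FiberRel r → InComponent r s → Thin s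

  -- number of fibers (= number of homogeneous components): the number of
  -- basis relations of the form 1_Δ, i.e. of indices r with r = col α α for some α
  numFibers : ℕ
  numFibers = count (λ r → any? (λ α → col X α α ≟ r))

  IsPermGroup : (Permutation′ (n X) → Set) → Set
  IsPermGroup G = G id
                × (∀ g h → G g → G h → G (g ∘ₚ h))
                × (∀ g → G g → G (flip g))

  Schurian : Set₁
  Schurian = Σ (Permutation′ (n X) → Set) λ G → IsPermGroup G ×
    (∀ α β γ δ → (col X α β ≡ col X γ δ ⇔
                  ∃ λ g → G g × g ⟨$⟩ʳ α ≡ γ × g ⟨$⟩ʳ β ≡ δ))

-- algebraic isomorphism X → Y: a bijection φ : S → S' preserving intersection numbers
-- (c^t_{rs} is computed at any (α,β) ∈ t, which is well defined by coherence)
AlgIso : (X Y : CC) → Permutation (m X) (m Y) → Set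
AlgIso X Y φ = ∀ r s t α β α' β' → col X α β ≡ t → col Y α' β' ≡ φ ⟨$⟩ʳ t →
  inter X α β r s ≡ inter Y α' β' (φ ⟨$⟩ʳ r) (φ ⟨$⟩ʳ s)

Separable : CC → Set
Separable X = ∀ (Y : CC) (φ : Permutation (m X) (m Y)) → AlgIso X Y φ →
  Σ (Permutation (n X) (n Y)) λ f →
    ∀ α β → col Y (f ⟨$⟩ʳ α) (f ⟨$⟩ʳ β) ≡ φ ⟨$⟩ʳ (col X α β)

module Submission where

-- Let φ : X → Y be an algebraic isomorphism, and say that (a , b) in X
-- corresponds to (a' , b') in Y if φ maps the colour of (a , b) to that of
-- (a' , b').  Since φ preserves intersection numbers, every path a → c → b
-- over a corresponding pair lifts to a path a' → c' → b' and back; hence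
-- correspondence respects loops and transposition.  If X is quasiregular, the
-- relations inside a fibre are thin, so a corresponding pair (a , a') of base
-- points determines, for every x in the fibre of a, a unique partner x'.  A
-- "base" -- pairwise corresponding points meeting every fibre -- therefore
-- induces a point bijection realising φ.  Any corresponding pair extends to a
-- consistent triangle, and with at most three fibres such a triangle can be
-- chosen to meet every fibre.  So every corresponding pair is the image of a
-- pair under a bijection inducing φ: for Y = X and φ = id this says that the
-- orbits of the automorphism group are the basis relations (schurity), and for
-- arbitrary φ it gives separability.

open import Defs
open import Data.Nat using (ℕ; zero; suc; _≤_; _<_; z≤n; s≤s)
open import Data.Nat.Properties using (m≤n⇒m≤1+n; ≤-trans; ≤⇒≯)
open import Data.Fin using (Fin)
open import Data.Fin.Patterns using (0F; 1F; 2F)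
open import Data.Fin.Properties using (_≟_; any?)
open import Data.Fin.Permutation as Perm
  using (Permutation; Permutation′; _⟨$⟩ʳ_; _⟨$⟩ˡ_; inverseˡ; inverseʳ)
open import Data.Product using (Σ; ∃; _×_; _,_; proj₁; proj₂)
open import Data.Sum using (_⊎_; inj₁; inj₂)
open import Data.Empty using (⊥; ⊥-elim)
open import Relation.Nullary using (Dec; yes; no; ¬_)
open import Relation.Nullary.Decidable using (_×-dec_; _⊎-dec_; ¬?)
open import Relation.Unary using (Decidable)
open import Relation.Binary.PropositionalEquality
open import Function using (_∘_)
open import Function.Bundles using (_⇔_; mk⇔; Equivalence)

tail? : ∀ {k} {P : Fin (suc k) → Set} → Decidable P → Decidable (λ i → P (Fin.suc i))
tail? d i = d (Fin.suc i)

count-witness : ∀ {k} {P : Fin k → Set} (d : Decidable P) → 0 < count d → ∃ P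
count-witness {suc k} d h with d Fin.zero
... | yes p = Fin.zero , p
... | no _ with count-witness (tail? d) h
...   | j , q = Fin.suc j , q

count-positive : ∀ {k} {P : Fin k → Set} (d : Decidable P) (j : Fin k) → P j → 0 < count d
count-positive {suc k} d j p with d Fin.zero
count-positive {suc k} d j           p | yes _ = s≤s z≤n
count-positive {suc k} d Fin.zero    p | no ¬p = ⊥-elim (¬p p)
count-positive {suc k} d (Fin.suc j) p | no _  = count-positive (tail? d) j p

count-mono : ∀ {k} {P Q : Fin k → Set} (dP : Decidable P) (dQ : Decidable Q) →
  (∀ j → Q j → P j) → count dQ ≤ count dP
count-mono {zero} dP dQ Q⊆P = z≤n
count-mono {suc k} dP dQ Q⊆P
  with count-mono (tail? dP) (tail? dQ) (Q⊆P ∘ Fin.suc) | dP Fin.zero | dQ Fin.zero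
... | tail≤ | yes _ | yes _ = s≤s tail≤
... | tail≤ | yes _ | no _  = m≤n⇒m≤1+n tail≤
... | _     | no ¬p | yes q = ⊥-elim (¬p (Q⊆P Fin.zero q))
... | tail≤ | no _  | no _  = tail≤

count-strict : ∀ {k} {P Q : Fin k → Set} (dP : Decidable P) (dQ : Decidable Q) →
  (∀ j → Q j → P j) → (i : Fin k) → P i → ¬ Q i → count dQ < count dP
count-strict dP dQ Q⊆P Fin.zero pi ¬qi with dP Fin.zero | dQ Fin.zero
... | no ¬p | _     = ⊥-elim (¬p pi)
... | yes _ | yes q = ⊥-elim (¬qi q)
... | yes _ | no _  = s≤s (count-mono (tail? dP) (tail? dQ) (Q⊆P ∘ Fin.suc))
count-strict dP dQ Q⊆P (Fin.suc i) pi ¬qi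
  with count-strict (tail? dP) (tail? dQ) (Q⊆P ∘ Fin.suc) i pi ¬qi | dP Fin.zero | dQ Fin.zero
... | tail< | yes _ | yes _ = s≤s tail<
... | tail< | yes _ | no _  = m≤n⇒m≤1+n tail<
... | _     | no ¬p | yes q = ⊥-elim (¬p (Q⊆P Fin.zero q))
... | tail< | no _  | no _  = tail<

four≤count : ∀ {k} {P : Fin k → Set} (dP : Decidable P) {a b c d : Fin k} →
  P a → P b → P c → P d →
  a ≢ b → a ≢ c → a ≢ d → b ≢ c → b ≢ d → c ≢ d → 4 ≤ count dP
four≤count {P = P} dP {a} {b} {c} {d} pa pb pc pd a≢b a≢c a≢d b≢c b≢d c≢d =
  ≤-trans 4≤#abcd (count-mono dP abcd? abcd⊆P)
  where
  a? = λ x → x ≟ a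
  ab? = λ x → a? x ⊎-dec (x ≟ b)
  abc? = λ x → ab? x ⊎-dec (x ≟ c)
  abcd? = λ x → abc? x ⊎-dec (x ≟ d)
  abcd⊆P : ∀ x → (((x ≡ a) ⊎ (x ≡ b)) ⊎ (x ≡ c)) ⊎ (x ≡ d) → P x
  abcd⊆P x (inj₁ (inj₁ (inj₁ refl))) = pa
  abcd⊆P x (inj₁ (inj₁ (inj₂ refl))) = pb
  abcd⊆P x (inj₁ (inj₂ refl)) = pc
  abcd⊆P x (inj₂ refl) = pd
  1≤#a : 1 ≤ count a?
  1≤#a = count-positive a? a refl
  2≤#ab : 2 ≤ count ab?
  2≤#ab = ≤-trans (s≤s 1≤#a)
    (count-strict ab? a? (λ _ → inj₁) b (inj₂ refl) (λ b≡a → a≢b (sym b≡a)))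
  3≤#abc : 3 ≤ count abc?
  3≤#abc = ≤-trans (s≤s 2≤#ab)
    (count-strict abc? ab? (λ _ → inj₁) c (inj₂ refl)
      λ { (inj₁ c≡a) → a≢c (sym c≡a) ; (inj₂ c≡b) → b≢c (sym c≡b) })
  4≤#abcd : 4 ≤ count abcd?
  4≤#abcd = ≤-trans (s≤s 3≤#abc)
    (count-strict abcd? abc? (λ _ → inj₁) d (inj₂ refl)
      λ { (inj₁ (inj₁ d≡a)) → a≢d (sym d≡a)
        ; (inj₁ (inj₂ d≡b)) → b≢d (sym d≡b)
        ; (inj₂ d≡c) → c≢d (sym d≡c) })

path-witness : ∀ {Z : CC} {a b r s} → 0 < inter Z a b r s →
  ∃ λ c → col Z a c ≡ r × col Z c b ≡ s
path-witness = count-witness _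

path-positive : ∀ {Z : CC} {a b} c → 0 < inter Z a b (col Z a c) (col Z c b)
path-positive c = count-positive _ c (refl , refl)

idAlgIso : (X : CC) → AlgIso X X Perm.id
idAlgIso X r s t α β α' β' αβ∈t α'β'∈t = coherent X r s α β α' β' (trans αβ∈t (sym α'β'∈t))

module AlgebraicIsomorphism (X Y : CC) (φ : Permutation (m X) (m Y)) (iso : AlgIso X Y φ) where

  Corr : Fin (n X) → Fin (n X) → Fin (n Y) → Fin (n Y) → Set
  Corr a b a' b' = col Y a' b' ≡ φ ⟨$⟩ʳ col X a b

  φ-injective : ∀ {r s} → φ ⟨$⟩ʳ r ≡ φ ⟨$⟩ʳ s → r ≡ s
  φ-injective {r} {s} φr≡φs = begin
    r                        ≡⟨ sym (inverseˡ φ) ⟩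
    φ ⟨$⟩ˡ (φ ⟨$⟩ʳ r)         ≡⟨ cong (φ ⟨$⟩ˡ_) φr≡φs ⟩
    φ ⟨$⟩ˡ (φ ⟨$⟩ʳ s)         ≡⟨ inverseˡ φ ⟩
    s                        ∎
    where open ≡-Reasoning

  corr-by-inverse : ∀ {a b a' b'} → col X a b ≡ φ ⟨$⟩ˡ col Y a' b' → Corr a b a' b'
  corr-by-inverse ab≡ = trans (sym (inverseʳ φ)) (cong (φ ⟨$⟩ʳ_) (sym ab≡))

  -- Paths lift along corresponding pairs, because φ preserves c^t_{rs}.
  lift-path : ∀ {a b a' b'} → Corr a b a' b' → ∀ c →
    ∃ λ c' → Corr a c a' c' × Corr c b c' b'
  lift-path {a} {b} {a'} {b'} corr c =
    path-witness {Y} (subst (0 <_) same-count (path-positive {X} c))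
    where
    same-count = iso (col X a c) (col X c b) (col X a b) a b a' b' refl corr

  lift-path⁻ : ∀ {a b a' b'} → Corr a b a' b' → ∀ c' →
    ∃ λ c → Corr a c a' c' × Corr c b c' b'
  lift-path⁻ {a} {b} {a'} {b'} corr c' =
    c , corr-by-inverse ac≡ , corr-by-inverse cb≡
    where
    r = φ ⟨$⟩ˡ col Y a' c'
    s = φ ⟨$⟩ˡ col Y c' b'
    same-count : inter X a b r s ≡ inter Y a' b' (φ ⟨$⟩ʳ r) (φ ⟨$⟩ʳ s)
    same-count = iso r s (col X a b) a b a' b' refl corr
    positive : 0 < inter Y a' b' (φ ⟨$⟩ʳ r) (φ ⟨$⟩ʳ s)
    positive = subst₂ (λ u v → 0 < inter Y a' b' u v) (sym (inverseʳ φ)) (sym (inverseʳ φ))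
                      (path-positive {Y} c')
    witness = path-witness {X} (subst (0 <_) (sym same-count) positive)
    c = proj₁ witness
    ac≡ = proj₁ (proj₂ witness)
    cb≡ = proj₂ (proj₂ witness)

  corr-loop : ∀ {a p' q'} → Corr a a p' q' → p' ≡ q'
  corr-loop {a} {p'} {q'} corr with lift-path⁻ corr p'
  ... | c , ac↦p'p' , ca↦p'q' = diag Y p' p' q' (trans ac↦p'p' (sym aa↦p'q'))
    where
    c≡a : c ≡ a
    c≡a = diag X a c a (φ-injective (trans (sym corr) ca↦p'q'))
    aa↦p'q' : Corr a c p' q'
    aa↦p'q' = subst (λ z → Corr a z p' q') (sym c≡a) corr

  corr-loopˡ : ∀ {a c a' c'} → Corr a c a' c' → Corr a a a' a'
  corr-loopˡ {a} {a' = a'} corr with lift-path corr a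
  ... | d' , aa↦a'd' , _ = subst (Corr a a a') (sym (corr-loop aa↦a'd')) aa↦a'd'

  corr-loopʳ : ∀ {a c a' c'} → Corr a c a' c' → Corr c c c' c'
  corr-loopʳ {c = c} {c' = c'} corr with lift-path corr c
  ... | d' , _ , cc↦d'c' = subst (λ z → Corr c c z c') (corr-loop cc↦d'c') cc↦d'c'

  corr-transpose : ∀ {a c a' c'} → Corr a c a' c' → Corr c a c' a'
  corr-transpose {a} {c} {a'} {c'} corr = trans da↦c'a' (cong (φ ⟨$⟩ʳ_) da≡ca)
    where
    lifted = lift-path⁻ (corr-loopˡ corr) c'
    d = proj₁ lifted
    ad↦a'c' : Corr a d a' c'
    ad↦a'c' = proj₁ (proj₂ lifted)
    da↦c'a' : Corr d a c' a'
    da↦c'a' = proj₂ (proj₂ lifted)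
    -- (a , d) has the colour r of (a , c), so (d , a) and (c , a) both have colour r*
    r = col X a c
    da≡ca : col X d a ≡ col X c a
    da≡ca = trans (Equivalence.from (tr-spec X r d a) (φ-injective (trans (sym ad↦a'c') corr)))
                  (sym (Equivalence.from (tr-spec X r c a) refl))

module QuasiregularFibres (X : CC) (qr : Quasiregular X) where

  -- The colour of the loop at x identifies the fibre containing x.
  fib : Fin (n X) → Fin (m X)
  fib x = col X x x

  open AlgebraicIsomorphism X X Perm.id (idAlgIso X)
    using () renaming (corr-loopˡ to loopˡ; corr-loopʳ to loopʳ)

  same-fibres : ∀ {p q a x} → col X p q ≡ col X a x → fib p ≡ fib a × fib q ≡ fib x
  same-fibres pq≡ax = loopˡ pq≡ax , loopʳ pq≡ax

  thin-in-fibre : ∀ {a x y} → fib a ≡ fib x → col X a y ≡ col X a x → x ≡ y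
  thin-in-fibre {a} {x} {y} a∼x ay≡ax =
    proj₁ (qr (fib a) (col X a x) fibre-relation in-component) a x y refl ay≡ax
    where
    fibre-relation : FiberRel X (fib a)
    fibre-relation α β αβ≡aa = diag X a α β (sym αβ≡aa)
    in-component : InComponent X (fib a) (col X a x)
    in-component p q pq≡ax = proj₁ (same-fibres pq≡ax) , trans (proj₂ (same-fibres pq≡ax)) (sym a∼x)

module Induced (X Y : CC) (φ : Permutation (m X) (m Y)) (iso : AlgIso X Y φ)
               (qr : Quasiregular X) where
  open AlgebraicIsomorphism X Y φ iso public
  open QuasiregularFibres X qr public

  corr-unique : ∀ {a x a' y z} → fib a ≡ fib x → Corr a x a' y → Corr a x a' z → y ≡ z
  corr-unique {a} {x} {a'} {y} {z} a∼x ax↦a'y ax↦a'z with lift-path⁻ ax↦a'z y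
  ... | c , ac↦a'y , cx↦yz = corr-loop (subst (λ w → Corr w x y z) (sym x≡c) cx↦yz)
    where
    x≡c : x ≡ c
    x≡c = thin-in-fibre a∼x (φ-injective (trans (sym ac↦a'y) ax↦a'y))

  corr-compose : ∀ {a x y a' x' y'} → fib a ≡ fib x →
    Corr a x a' x' → Corr a y a' y' → Corr x y x' y'
  corr-compose {a} {x} {y} {y' = y'} a∼x ax↦a'x' ay↦a'y' with lift-path ay↦a'y' x
  ... | z' , ax↦a'z' , xy↦z'y' =
    subst (λ w → Corr x y w y') (corr-unique a∼x ax↦a'z' ax↦a'x') xy↦z'y'

  Inducing : Permutation (n X) (n Y) → Set
  Inducing π = ∀ x y → Corr x y (π ⟨$⟩ʳ x) (π ⟨$⟩ʳ y)

  ExtendsPoint : Fin (n X) → Fin (n Y) → Set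
  ExtendsPoint a a' = Σ (Permutation (n X) (n Y)) λ π → Inducing π × π ⟨$⟩ʳ a ≡ a'

  Extends : Fin (n X) → Fin (n X) → Fin (n Y) → Fin (n Y) → Set
  Extends a b a' b' = Σ (Permutation (n X) (n Y)) λ π →
    Inducing π × π ⟨$⟩ʳ a ≡ a' × π ⟨$⟩ʳ b ≡ b'

  forget-second : ∀ {a b a' b'} → Extends a b a' b' → ExtendsPoint a a'
  forget-second (π , inducing , πa , _) = π , inducing , πa

  record Base (k : ℕ) : Set where
    field
      B : Fin k → Fin (n X)
      B' : Fin k → Fin (n Y)
      consistent : ∀ i j → Corr (B i) (B j) (B' i) (B' j)
      fibreOf : Fin (n X) → Fin k
      inFibre : ∀ x → fib x ≡ fib (B (fibreOf x))

  -- Every base induces a point bijection extending it: x in the fibre of B i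
  -- goes to its unique partner x' with (B i , x) ↦ (B' i , x').
  module FromBase {k : ℕ} (base : Base k) where
    open Base base

    f : Fin (n X) → Fin (n Y)
    f x = proj₁ (lift-path (consistent (fibreOf x) (fibreOf x)) x)

    f-own : ∀ x → Corr (B (fibreOf x)) x (B' (fibreOf x)) (f x)
    f-own x = proj₁ (proj₂ (lift-path (consistent (fibreOf x) (fibreOf x)) x))

    f-any : ∀ i x → Corr (B i) x (B' i) (f x)
    f-any i x = corr-transpose (corr-compose (sym (inFibre x)) (f-own x) (consistent (fibreOf x) i))

    f-inducing : ∀ x y → Corr x y (f x) (f y)
    f-inducing x y = corr-compose (sym (inFibre x)) (f-own x) (f-any (fibreOf x) y)

    f-base : ∀ i → f (B i) ≡ B' i
    f-base i = corr-unique (sym (inFibre (B i))) (f-own (B i)) (consistent (fibreOf (B i)) i)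

    -- The base index of the fibre of Y containing y, read off a pair of X
    -- whose colour is φ⁻¹ of the loop at y.
    fibreOf′ : Fin (n Y) → Fin k
    fibreOf′ y = fibreOf (proj₁ (nonempty X (φ ⟨$⟩ˡ col Y y y)))

    inFibre′ : ∀ y → col Y y y ≡ col Y (B' (fibreOf′ y)) (B' (fibreOf′ y))
    inFibre′ y with nonempty X (φ ⟨$⟩ˡ col Y y y)
    ... | p , q , pq≡ = begin
      col Y y y                   ≡⟨ corr-loopˡ (corr-by-inverse {p} {q} pq≡) ⟩
      φ ⟨$⟩ʳ fib p                ≡⟨ cong (φ ⟨$⟩ʳ_) (inFibre p) ⟩
      φ ⟨$⟩ʳ fib (B (fibreOf p))  ≡⟨ sym (consistent (fibreOf p) (fibreOf p)) ⟩
      col Y (B' (fibreOf p)) (B' (fibreOf p)) ∎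
      where open ≡-Reasoning

    g : Fin (n Y) → Fin (n X)
    g y = proj₁ (lift-path⁻ (consistent (fibreOf′ y) (fibreOf′ y)) y)

    g-own : ∀ y → Corr (B (fibreOf′ y)) (g y) (B' (fibreOf′ y)) y
    g-own y = proj₁ (proj₂ (lift-path⁻ (consistent (fibreOf′ y) (fibreOf′ y)) y))

    fibre-transfer : ∀ x y → let i = fibreOf′ y in Corr (B i) x (B' i) y → fib (B i) ≡ fib x
    fibre-transfer x y corr = φ-injective (begin
      φ ⟨$⟩ʳ fib (B i)   ≡⟨ sym (consistent i i) ⟩
      col Y (B' i) (B' i) ≡⟨ sym (inFibre′ y) ⟩
      col Y y y          ≡⟨ corr-loopʳ corr ⟩
      φ ⟨$⟩ʳ fib x       ∎)
      where
      i = fibreOf′ y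
      open ≡-Reasoning

    f∘g : ∀ y → f (g y) ≡ y
    f∘g y = corr-unique (fibre-transfer (g y) y (g-own y)) (f-any (fibreOf′ y) (g y)) (g-own y)

    g∘f : ∀ x → g (f x) ≡ x
    g∘f x = sym (thin-in-fibre (fibre-transfer x (f x) (f-any i x))
                                (φ-injective (trans (sym (g-own (f x))) (f-any i x))))
      where i = fibreOf′ (f x)

    π : Permutation (n X) (n Y)
    π = Perm.permutation f g f∘g g∘f

  extend-base : ∀ {k} (base : Base k) i j →
    Extends (Base.B base i) (Base.B base j) (Base.B' base i) (Base.B' base j)
  extend-base base i j = π , f-inducing , f-base i , f-base j
    where open FromBase base

triple : ∀ {A : Set} → A → A → A → Fin 3 → A
triple a b c 0F = a
triple a b c 1F = b
triple a b c 2F = c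

module ThreeFibres (X Y : CC) (φ : Permutation (m X) (m Y)) (iso : AlgIso X Y φ)
                   (qr : Quasiregular X) (three : numFibers X ≤ 3) where
  open Induced X Y φ iso qr public

  no-four-fibres : ∀ p q r x → fib p ≢ fib q → fib p ≢ fib r → fib q ≢ fib r →
    fib p ≢ fib x → fib q ≢ fib x → fib r ≢ fib x → ⊥
  no-four-fibres p q r x p≁q p≁r q≁r p≁x q≁x r≁x =
    ≤⇒≯ three (four≤count (λ t → any? (λ α → col X α α ≟ t)) (p , refl) (q , refl) (r , refl) (x , refl)
                           p≁q p≁r p≁x q≁r q≁x r≁x)

  Covers : Fin (n X) → Fin (n X) → Fin (n X) → Set
  Covers a b c = ∀ x → ∃ λ i → fib x ≡ fib (triple a b c i)

  -- Points a and b in distinct fibres can be completed by a point c so that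
  -- a, b, c meet every fibre (c = b when a and b already do).
  third-point : ∀ a b → fib a ≢ fib b → ∃ (Covers a b)
  third-point a b a≁b with any? (λ x → ¬? (fib a ≟ fib x) ×-dec ¬? (fib b ≟ fib x))
  ... | yes (c , a≁c , b≁c) = c , cover
    where
    cover : Covers a b c
    cover x with fib x ≟ fib a | fib x ≟ fib b | fib x ≟ fib c
    ... | yes x∼a | _ | _ = 0F , x∼a
    ... | no _ | yes x∼b | _ = 1F , x∼b
    ... | no _ | no _ | yes x∼c = 2F , x∼c
    ... | no a≁x | no b≁x | no c≁x =
      ⊥-elim (no-four-fibres a b c x a≁b a≁c b≁c (a≁x ∘ sym) (b≁x ∘ sym) (c≁x ∘ sym))
  ... | no no-third = b , cover
    where
    cover : Covers a b b
    cover x with fib x ≟ fib a | fib x ≟ fib b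
    ... | yes x∼a | _ = 0F , x∼a
    ... | no _ | yes x∼b = 1F , x∼b
    ... | no a≁x | no b≁x = ⊥-elim (no-third (x , a≁x ∘ sym , b≁x ∘ sym))

  triangle-base : ∀ {a b c a' b' c'} →
    Corr a b a' b' → Corr a c a' c' → Corr b c b' c' → Covers a b c → Base 3
  triangle-base {a} {b} {c} {a'} {b'} {c'} ab ac bc cover = record
    { B = triple a b c ; B' = triple a' b' c' ; consistent = consistent
    ; fibreOf = λ x → proj₁ (cover x) ; inFibre = λ x → proj₂ (cover x) }
    where
    consistent : ∀ i j → Corr (triple a b c i) (triple a b c j) (triple a' b' c' i) (triple a' b' c' j)
    consistent 0F 0F = corr-loopˡ ab
    consistent 0F 1F = ab
    consistent 0F 2F = ac
    consistent 1F 0F = corr-transpose ab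
    consistent 1F 1F = corr-loopʳ ab
    consistent 1F 2F = bc
    consistent 2F 0F = corr-transpose ac
    consistent 2F 1F = corr-transpose bc
    consistent 2F 2F = corr-loopʳ ac

  extend-across : ∀ {a b a' b'} → Corr a b a' b' → fib a ≢ fib b → Extends a b a' b'
  extend-across {a} {b} ab a≁b with third-point a b a≁b
  ... | c , cover with lift-path ab c
  ...   | c' , ac , cb = extend-base (triangle-base ab ac (corr-transpose cb) cover) 0F 1F

  extend-loop : ∀ {a a'} → Corr a a a' a' → ExtendsPoint a a'
  extend-loop {a} {a'} aa with any? (λ x → ¬? (fib a ≟ fib x))
  ... | yes (c , a≁c) = forget-second (extend-across (proj₁ (proj₂ (lift-path aa c))) a≁c)
  ... | no one-fibre = forget-second (extend-base single 0F 0F)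
    where
    in-fibre : ∀ x → fib x ≡ fib a
    in-fibre x with fib a ≟ fib x
    ... | yes a∼x = sym a∼x
    ... | no a≁x = ⊥-elim (one-fibre (x , a≁x))
    single : Base 1
    single = record { B = λ _ → a ; B' = λ _ → a' ; consistent = λ _ _ → aa
                    ; fibreOf = λ _ → 0F ; inFibre = in-fibre }

  -- Every corresponding pair extends to an inducing bijection; within a fibre
  -- the image of the second point is forced by the first.
  extend : ∀ {a b a' b'} → Corr a b a' b' → Extends a b a' b'
  extend {a} {b} {a'} {b'} ab with fib a ≟ fib b
  ... | no a≁b = extend-across ab a≁b
  ... | yes a∼b = π , inducing , πa , πb
    where
    extended = extend-loop (corr-loopˡ ab)
    π = proj₁ extended
    inducing = proj₁ (proj₂ extended)
    πa = proj₂ (proj₂ extended)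
    πb : π ⟨$⟩ʳ b ≡ b'
    πb = corr-unique a∼b (subst (λ z → Corr a b z (π ⟨$⟩ʳ b)) πa (inducing a b)) ab

inhabited? : ∀ k → Dec (Fin k)
inhabited? zero = no λ ()
inhabited? (suc k) = yes Fin.zero

empty-permutation : ∀ {k l} → ¬ Fin k → ¬ Fin l → Permutation k l
empty-permutation ¬k ¬l =
  Perm.permutation (⊥-elim ∘ ¬k) (⊥-elim ∘ ¬l) (⊥-elim ∘ ¬l) (⊥-elim ∘ ¬k)

Automorphism : (X : CC) → Permutation′ (n X) → Set
Automorphism X g = ∀ α β → col X (g ⟨$⟩ʳ α) (g ⟨$⟩ʳ β) ≡ col X α β

automorphism-group : (X : CC) → IsPermGroup X (Automorphism X)
automorphism-group X = (λ α β → refl) , composition , inverse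
  where
  composition : ∀ g h → Automorphism X g → Automorphism X h → Automorphism X (g Perm.∘ₚ h)
  composition g h aut-g aut-h α β = trans (aut-h _ _) (aut-g α β)
  inverse : ∀ g → Automorphism X g → Automorphism X (Perm.flip g)
  inverse g aut-g α β =
    sym (trans (cong₂ (col X) (sym (inverseʳ g)) (sym (inverseʳ g))) (aut-g _ _))

theorem1p3 : (X : CC) → Quasiregular X → numFibers X ≤ 3 → Schurian X × Separable X
theorem1p3 X qr three = (Automorphism X , automorphism-group X , orbits) , separable
  where
  open ThreeFibres X X Perm.id (idAlgIso X) qr three using () renaming (extend to extend-auto)

  -- Basis relations are automorphism orbits: equal colours extend to an automorphism.
  orbits : ∀ α β γ δ →
    (col X α β ≡ col X γ δ ⇔ ∃ λ g → Automorphism X g × g ⟨$⟩ʳ α ≡ γ × g ⟨$⟩ʳ β ≡ δ)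
  orbits α β γ δ = mk⇔ (λ αβ≡γδ → extend-auto (sym αβ≡γδ))
                       (λ { (g , aut , refl , refl) → sym (aut α β) })

  -- Any algebraic isomorphism is induced: extend a loop of X and a corresponding pair of Y.
  separable : Separable X
  separable Y φ iso with inhabited? (n X)
  ... | yes x with nonempty Y (φ ⟨$⟩ʳ col X x x)
  ...   | y , z , xx↦yz = proj₁ extended , proj₁ (proj₂ extended)
    where extended = ThreeFibres.extend X Y φ iso qr three xx↦yz
  separable Y φ iso | no empty = empty-permutation empty empty-Y , λ x → ⊥-elim (empty x)
    where
    -- every point of Y has a loop, whose colour is the image of a colour of X
    empty-Y : Fin (n Y) → ⊥
    empty-Y y = empty (proj₁ (nonempty X (φ ⟨$⟩ˡ col Y y y)))
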